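{- Let $n = p_1^{\alpha_1}p_2^{\alpha_2}\cdots p_r^{\alpha_r}$ with $r \geq 2$, primes $p_1<p_2<\cdots<p_r$ and positive integers $\alpha_1,\dots,\alpha_r$, and let $C_n$ be the cyclic group of order $n$. Let $1 \leq k \leq r$ and let $\beta < \gamma$ be positive integers. If $x, y \in C_n$ have orders $p_k^{\beta}$ and $p_k^{\gamma}$ respectively, then in the power graph $\mathcal{P}(C_n)$ we have $|N([x])| > |N([y])|$.
   Context: The power graph $\mathcal{P}(G)$ of a group $G$ is the simple undirected graph with vertex set $G$ in which two distinct vertices are adjacent if one of them is a positive power of the other. For a set $A$ of vertices of a graph, $N(A)$ denotes the set of all vertices not in $A$ that are adjacent to some vertex of $A$. For $x$ in a group, $[x]$ denotes the set of generators of the cyclic subgroup $\langle x \rangle$. -}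

module Defs where

open import Data.Nat using (ℕ; zero; suc; _+_; _*_; _^_; _≤_; _<_; NonZero)
open import Data.Nat.DivMod using (_mod_)
open import Data.Fin using (Fin; toℕ)
import Data.Fin as F
open import Data.Product using (Σ; _×_; ∃; ∃-syntax)
open import Data.Sum using (_⊎_)
open import Relation.Binary.PropositionalEquality using (_≡_; _≢_)
open import Relation.Nullary using (¬_)

prodFin : (r : ℕ) → (Fin r → ℕ) → ℕ
prodFin zero    f = 1
prodFin (suc r) f = f F.zero * prodFin r (λ i → f (F.suc i))

-- The cyclic group C_n is modelled as (Fin n, + mod n), with identity 0.
-- pow n m x is the m-th power x^m, i.e. m·x mod n.
module Cyclic (n : ℕ) .{{_ : NonZero n}} where

  pow : ℕ → Fin n → Fin n
  pow m x = (m * toℕ x) mod n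

  identity : Fin n
  identity = 0 mod n

  HasOrder : Fin n → ℕ → Set
  HasOrder x d = (1 ≤ d) × (pow d x ≡ identity)
               × (∀ m → 1 ≤ m → pow m x ≡ identity → d ≤ m)

  PosPow : Fin n → Fin n → Set
  PosPow a b = ∃[ m ] ((1 ≤ m) × (pow m a ≡ b))

  Adj : Fin n → Fin n → Set
  Adj a b = (a ≢ b) × (PosPow a b ⊎ PosPow b a)

  InSub : Fin n → Fin n → Set
  InSub y x = ∃[ m ] (pow m x ≡ y)

  Gen : Fin n → Fin n → Set
  Gen x y = InSub y x × InSub x y

  NGen : Fin n → Fin n → Set
  NGen x v = ¬ Gen x v × ∃[ a ] (Gen x a × Adj a v)

-- The cyclic subgroup ⟨v⟩ is determined by its index gcd(v, n), and v ∈ N([x])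
-- exactly when gcd(v, n) ≠ gcd(x, n) and the two indices are comparable under divisibility. For the
-- indices a = n / p^β of x and b = n / p^γ of y, b properly divides a, and the divisors of n that are
-- multiples of b are the b p^j, a chain through a. So the map sending v ∈ [x] to v + y and fixing
-- every other vertex injects N([y]) into N([x]): [x] ⊆ N([y]) is sent into [y] ⊆ N([x]), because
-- b p divides v but not y, and y ∈ N([x]) is never hit.
module Submission where

open import Defs
open import Data.Nat
  using ( ℕ; zero; suc; _+_; _*_; _∸_; _^_; _≤_; _<_; _/_; _%_; z≤n; s≤s
        ; NonZero; ≢-nonZero; ≢-nonZero⁻¹; >-nonZero; >-nonZero⁻¹; nonTrivial⇒≢1)
open import Data.Nat.Properties
open import Data.Nat.DivMod
open import Data.Nat.Divisibility
open import Data.Nat.GCD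
open import Data.Nat.Coprimality using (Coprime; coprime-divisor; coprime-/gcd)
import Data.Nat.Coprimality as Coprime
open import Data.Nat.Primality using (Prime; prime⇒nonZero; prime⇒nonTrivial; prime⇒irreducible)
open import Data.Nat.Tactic.RingSolver using (solve-∀)
open import Data.Fin using (Fin; toℕ; zero; suc)
import Data.Fin as F
open import Data.Fin.Properties using (toℕ-injective; toℕ<n; toℕ-fromℕ<; injective⇒≤)
open import Data.List using (List; length; lookup)
open import Data.List.Membership.Propositional using (_∈_)
open import Data.List.Membership.Propositional.Properties using (∈-lookup)
open import Data.List.Membership.Setoid.Properties using (index-injective)
import Data.List.Relation.Unary.All as All
open import Data.List.Relation.Unary.AllPairs using (_∷_)
open import Data.List.Relation.Unary.Any using (index)
open import Data.List.Relation.Unary.Unique.Propositional using (Unique)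
open import Data.Product using (_×_; _,_; ∃-syntax)
open import Data.Sum using (_⊎_; inj₁; inj₂)
import Data.Sum as Sum
open import Data.Empty using (⊥-elim)
open import Function using (_∘_)
open import Function.Bundles using (_⇔_; mk⇔; Equivalence)
import Function.Properties.Equivalence as ⇔
open import Relation.Nullary using (¬_; yes; no)
open import Relation.Binary.PropositionalEquality

module _ {A : Set} where

  lookup-injective : ∀ {xs : List A} → Unique xs → ∀ {i j} → lookup xs i ≡ lookup xs j → i ≡ j
  lookup-injective (_ ∷ _)  {zero}  {zero}  _  = refl
  lookup-injective (x∉ ∷ _) {zero}  {suc j} eq = ⊥-elim (All.lookup x∉ (∈-lookup j) eq)
  lookup-injective (x∉ ∷ _) {suc i} {zero}  eq = ⊥-elim (All.lookup x∉ (∈-lookup i) (sym eq))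
  lookup-injective (_ ∷ u)  {suc i} {suc j} eq = cong suc (lookup-injective u eq)

module _ {A B : Set} (f : A → B) {xs : List A} {ys : List B} where

  injectiveOn∧missing⇒length< : Unique xs
    → (∀ {v} → v ∈ xs → f v ∈ ys)
    → (∀ {v w} → v ∈ xs → w ∈ xs → f v ≡ f w → v ≡ w)
    → ∀ {z} → z ∈ ys → (∀ {v} → v ∈ xs → f v ≢ z)
    → length xs < length ys
  injectiveOn∧missing⇒length< uniq into inj {z} z∈ys miss = injective⇒≤ g-injective
    where
    g : Fin (suc (length xs)) → Fin (length ys)
    g zero    = index z∈ys
    g (suc i) = index (into (∈-lookup i))

    index-injective′ : ∀ {u w} (u∈ys : u ∈ ys) (w∈ys : w ∈ ys) → index u∈ys ≡ index w∈ys → u ≡ w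
    index-injective′ = index-injective (setoid B)

    g-injective : ∀ {i j} → g i ≡ g j → i ≡ j
    g-injective {zero}  {zero}  _  = refl
    g-injective {zero}  {suc j} eq = ⊥-elim (miss (∈-lookup j) (sym (index-injective′ z∈ys _ eq)))
    g-injective {suc i} {zero}  eq = ⊥-elim (miss (∈-lookup i) (index-injective′ _ z∈ys eq))
    g-injective {suc i} {suc j} eq =
      cong suc (lookup-injective uniq (inj (∈-lookup i) (∈-lookup j) (index-injective′ _ _ eq)))

∣p^k⇒≡p^j : ∀ {p k d} → Prime p → d ∣ p ^ k → ∃[ j ] d ≡ p ^ j
∣p^k⇒≡p^j {k = zero} _ d∣1 = 0 , ∣1⇒≡1 d∣1
∣p^k⇒≡p^j {p} {suc k} {d} pr d∣p^[1+k] with p ∣? d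
... | yes (divides q refl) =
  let instance _ = prime⇒nonZero pr
      j , q≡p^j = ∣p^k⇒≡p^j {k = k} pr (*-cancelʳ-∣ p (subst (q * p ∣_) (*-comm p (p ^ k)) d∣p^[1+k]))
  in suc j , trans (*-comm q p) (cong (p *_) q≡p^j)
... | no p∤d = ∣p^k⇒≡p^j {k = k} pr (coprime-divisor d⊥p d∣p^[1+k])
  where
  d⊥p : Coprime d p
  d⊥p (c∣d , c∣p) with prime⇒irreducible pr c∣p
  ... | inj₁ c≡1 = c≡1
  ... | inj₂ refl = ⊥-elim (p∤d c∣d)

^-monoʳ-∣ : ∀ p {i j} → i ≤ j → p ^ i ∣ p ^ j
^-monoʳ-∣ p {j = j} z≤n = 1∣ (p ^ j)
^-monoʳ-∣ p (s≤s i≤j) = *-monoʳ-∣ p (^-monoʳ-∣ p i≤j)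

∣b*p^k⇒≡b*p^j : ∀ {p k b c} → Prime p → .{{NonZero b}}
  → b ∣ c → c ∣ b * p ^ k → ∃[ j ] c ≡ b * p ^ j
∣b*p^k⇒≡b*p^j {p} {k} {b} pr (divides e refl) e*b∣b*p^k
  with j , e≡p^j ← ∣p^k⇒≡p^j {k = k} pr (*-cancelʳ-∣ b (subst (e * b ∣_) (*-comm b (p ^ k)) e*b∣b*p^k))
  = j , trans (*-comm e b) (cong (b *_) e≡p^j)

b*p^i-comparable : ∀ b p {i j a c} → a ≡ b * p ^ i → c ≡ b * p ^ j → a ∣ c ⊎ c ∣ a
b*p^i-comparable b p {i} {j} refl refl with ≤-total i j
... | inj₁ i≤j = inj₁ (*-monoʳ-∣ b (^-monoʳ-∣ p i≤j))
... | inj₂ j≤i = inj₂ (*-monoʳ-∣ b (^-monoʳ-∣ p j≤i))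

b*p∤b : ∀ {p b} → Prime p → .{{NonZero b}} → ¬ b * p ∣ b
b*p∤b {p} {b} pr b*p∣b =
  nonTrivial⇒≢1 {{prime⇒nonTrivial pr}}
    (∣1⇒≡1 (*-cancelˡ-∣ b (subst (b * p ∣_) (sym (*-identityʳ b)) b*p∣b)))

gcd[m,n]-nonZero : ∀ m n .{{_ : NonZero n}} → NonZero (gcd m n)
gcd[m,n]-nonZero m n = ≢-nonZero (gcd[m,n]≢0 m n (inj₂ (≢-nonZero⁻¹ n)))

gcd[u+y,n]≡gcd[y,n] : ∀ {p k n u y} .{{_ : NonZero n}} → Prime p
  → n ≡ gcd y n * p ^ k → gcd y n * p ∣ u → gcd (u + y) n ≡ gcd y n
gcd[u+y,n]≡gcd[y,n] {p} {k} {n} {u} {y} pr n≡b*p^k b*p∣u =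
  c≡b (∣b*p^k⇒≡b*p^j {k = k} pr b∣c (subst (c ∣_) n≡b*p^k (gcd[m,n]∣n (u + y) n)))
  where
  b = gcd y n
  c = gcd (u + y) n
  instance
    b≢0 : NonZero b
    b≢0 = gcd[m,n]-nonZero y n

  b∣c : b ∣ c
  b∣c = gcd-greatest (∣m∣n⇒∣m+n (∣-trans (m∣m*n p) b*p∣u) (gcd[m,n]∣m y n)) (gcd[m,n]∣n y n)

  c≡b : ∃[ j ] c ≡ b * p ^ j → c ≡ b
  c≡b (zero , c≡b*1) = trans c≡b*1 (*-identityʳ b)
  c≡b (suc j , c≡b*p^[1+j]) = ⊥-elim (b*p∤b pr b*p∣b)
    where
    b*p∣c : b * p ∣ c
    b*p∣c = subst (b * p ∣_) (trans (*-assoc b p (p ^ j)) (sym c≡b*p^[1+j])) (m∣m*n (p ^ j))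
    b*p∣b : b * p ∣ b
    b*p∣b = gcd-greatest (∣m+n∣m⇒∣n (∣-trans b*p∣c (gcd[m,n]∣m (u + y) n)) b*p∣u)
                         (∣-trans b*p∣c (gcd[m,n]∣n (u + y) n))

module _ {n : ℕ} .{{_ : NonZero n}} where

  %-cong-*ˡ : ∀ t {a b} → a % n ≡ b % n → (t * a) % n ≡ (t * b) % n
  %-cong-*ˡ t {a} {b} eq = begin
    (t * a) % n               ≡⟨ %-distribˡ-* t a n ⟩
    (t % n * (a % n)) % n     ≡⟨ cong (λ z → (t % n * z) % n) eq ⟩
    (t % n * (b % n)) % n     ≡⟨ %-distribˡ-* t b n ⟨
    (t * b) % n               ∎
    where open ≡-Reasoning

  %-cong-+ʳ : ∀ c {a b} → a % n ≡ b % n → (a + c) % n ≡ (b + c) % n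
  %-cong-+ʳ c {a} {b} eq = begin
    (a + c) % n               ≡⟨ %-distribˡ-+ a c n ⟩
    (a % n + c % n) % n       ≡⟨ cong (λ z → (z + c % n) % n) eq ⟩
    (b % n + c % n) % n       ≡⟨ %-distribˡ-+ b c n ⟨
    (b + c) % n               ∎
    where open ≡-Reasoning

  +-cancelʳ-% : ∀ {v w} y → v < n → w < n → y ≤ n → (v + y) % n ≡ (w + y) % n → v ≡ w
  +-cancelʳ-% {v} {w} y v<n w<n y≤n eq = begin
    v                          ≡⟨ undo-+ v<n ⟨
    ((v + y) + (n ∸ y)) % n    ≡⟨ %-cong-+ʳ (n ∸ y) eq ⟩
    ((w + y) + (n ∸ y)) % n    ≡⟨ undo-+ w<n ⟩
    w                          ∎
    where
    open ≡-Reasoning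
    undo-+ : ∀ {u} → u < n → ((u + y) + (n ∸ y)) % n ≡ u
    undo-+ {u} u<n = begin
      ((u + y) + (n ∸ y)) % n  ≡⟨ cong (_% n) (trans (+-assoc u y (n ∸ y)) (cong (u +_) (m+[n∸m]≡n y≤n))) ⟩
      (u + n) % n              ≡⟨ [m+n]%n≡m%n u n ⟩
      u % n                    ≡⟨ m<n⇒m%n≡m u<n ⟩
      u                        ∎

  gcd[m%n,n]≡gcd[m,n] : ∀ m → gcd (m % n) n ≡ gcd m n
  gcd[m%n,n]≡gcd[m,n] m = ∣-antisym
    (gcd-greatest (∣n∣m%n⇒∣m (gcd[m,n]∣n (m % n) n) (gcd[m,n]∣m (m % n) n)) (gcd[m,n]∣n (m % n) n))
    (gcd-greatest (%-presˡ-∣ (gcd[m,n]∣m m n) (gcd[m,n]∣n m n)) (gcd[m,n]∣n m n))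

-- In the Bézout case g + x v = y n, the coefficient -x is replaced by x (n - 1).
gcd≡multiple-% : ∀ v n .{{_ : NonZero n}} → ∃[ m ] (m * v) % n ≡ gcd v n % n
gcd≡multiple-% v n@(suc n-1) with Bézout.identity (gcd-GCD v n)
... | Bézout.+- x y g+y*n≡x*v = x , (begin
  (x * v) % n                       ≡⟨ cong (_% n) g+y*n≡x*v ⟨
  (gcd v n + y * n) % n             ≡⟨ [m+kn]%n≡m%n (gcd v n) y n ⟩
  gcd v n % n                       ∎)
  where open ≡-Reasoning
... | Bézout.-+ x y g+x*v≡y*n = x * n-1 , (begin
  (x * n-1 * v) % n                 ≡⟨ [m+kn]%n≡m%n (x * n-1 * v) y n ⟨
  (x * n-1 * v + y * n) % n         ≡⟨ cong (λ z → (x * n-1 * v + z) % n) g+x*v≡y*n ⟨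
  (x * n-1 * v + (gcd v n + x * v)) % n  ≡⟨ cong (_% n) (regroup x n-1 v (gcd v n)) ⟩
  (gcd v n + x * v * n) % n         ≡⟨ [m+kn]%n≡m%n (gcd v n) (x * v) n ⟩
  gcd v n % n                       ∎)
  where
  open ≡-Reasoning
  regroup : ∀ x m v g → x * m * v + (g + x * v) ≡ g + x * v * suc m
  regroup = solve-∀

n∣m*v⇔q∣m : ∀ {m v n q} .{{_ : NonZero n}} → q * gcd v n ≡ n → n ∣ m * v ⇔ q ∣ m
n∣m*v⇔q∣m {m} {v} {n} {q} q*g≡n = mk⇔ to from
  where
  g = gcd v n
  instance
    g≢0 : NonZero g
    g≢0 = gcd[m,n]-nonZero v n
  v/g*g≡v : v / g * g ≡ v
  v/g*g≡v = m/n*n≡m (gcd[m,n]∣m v n)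
  n/g≡q : n / g ≡ q
  n/g≡q = trans (cong (_/ g) (sym q*g≡n)) (m*n/n≡m q g)
  q⊥v/g : Coprime q (v / g)
  q⊥v/g = subst (λ z → Coprime z (v / g)) n/g≡q (Coprime.sym (coprime-/gcd v n))

  m*v≡v/g*m*g : m * v ≡ v / g * m * g
  m*v≡v/g*m*g = begin
    m * v              ≡⟨ cong (m *_) v/g*g≡v ⟨
    m * (v / g * g)    ≡⟨ *-assoc m (v / g) g ⟨
    m * (v / g) * g    ≡⟨ cong (_* g) (*-comm m (v / g)) ⟩
    v / g * m * g      ∎
    where open ≡-Reasoning

  to : n ∣ m * v → q ∣ m
  to n∣m*v = coprime-divisor q⊥v/g (*-cancelʳ-∣ g (subst₂ _∣_ (sym q*g≡n) m*v≡v/g*m*g n∣m*v))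

  from : q ∣ m → n ∣ m * v
  from q∣m = subst (_∣ m * v) q*g≡n (*-pres-∣ q∣m (gcd[m,n]∣m v n))

module CyclicGroup (n : ℕ) .{{_ : NonZero n}} where
  open Cyclic n public

  -- gcd(v, n) is the index of ⟨v⟩ in C_n; containment of cyclic subgroups is reverse divisibility of indices.
  index⟨_⟩ : Fin n → ℕ
  index⟨ v ⟩ = gcd (toℕ v) n

  toℕ-mod : ∀ m → toℕ (m mod n) ≡ m % n
  toℕ-mod m = toℕ-fromℕ< (m%n<n m n)

  toℕ-identity : toℕ identity ≡ 0
  toℕ-identity = trans (toℕ-mod 0) (m*n%n≡0 0 n)

  index⟨identity⟩ : index⟨ identity ⟩ ≡ n
  index⟨identity⟩ = trans (cong (λ z → gcd z n) toℕ-identity) (gcd-identityˡ n)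

  index∣toℕ⇒InSub : ∀ {u v} → index⟨ v ⟩ ∣ toℕ u → InSub u v
  index∣toℕ⇒InSub {u} {v} (divides t u≡t*g) with m , m*v≡g ← gcd≡multiple-% (toℕ v) n =
    t * m , toℕ-injective (begin
      toℕ (pow (t * m) v)        ≡⟨ toℕ-mod (t * m * toℕ v) ⟩
      (t * m * toℕ v) % n        ≡⟨ cong (_% n) (*-assoc t m (toℕ v)) ⟩
      (t * (m * toℕ v)) % n      ≡⟨ %-cong-*ˡ t m*v≡g ⟩
      (t * index⟨ v ⟩) % n       ≡⟨ cong (_% n) u≡t*g ⟨
      toℕ u % n                  ≡⟨ m<n⇒m%n≡m (toℕ<n u) ⟩
      toℕ u                      ∎)
    where open ≡-Reasoning

  InSub⇒index∣index : ∀ {u v} → InSub u v → index⟨ v ⟩ ∣ index⟨ u ⟩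
  InSub⇒index∣index {v = v} (m , refl) = gcd-greatest
    (subst (index⟨ v ⟩ ∣_) (sym (toℕ-mod (m * toℕ v)))
      (%-presˡ-∣ (∣n⇒∣m*n m (gcd[m,n]∣m (toℕ v) n)) (gcd[m,n]∣n (toℕ v) n)))
    (gcd[m,n]∣n (toℕ v) n)

  index∣index⇒InSub : ∀ {u v} → index⟨ v ⟩ ∣ index⟨ u ⟩ → InSub u v
  index∣index⇒InSub {u} g∣g = index∣toℕ⇒InSub (∣-trans g∣g (gcd[m,n]∣m (toℕ u) n))

  -- Adding n to the exponent makes it positive without changing the power.
  InSub⇒PosPow : ∀ {u v} → InSub u v → PosPow v u
  InSub⇒PosPow {v = v} (m , refl) = n + m , ≤-trans (>-nonZero⁻¹ n) (m≤m+n n m) , toℕ-injective (begin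
    toℕ (pow (n + m) v)          ≡⟨ toℕ-mod ((n + m) * toℕ v) ⟩
    ((n + m) * toℕ v) % n        ≡⟨ cong (_% n) (*-distribʳ-+ (toℕ v) n m) ⟩
    (n * toℕ v + m * toℕ v) % n  ≡⟨ %-remove-+ˡ (m * toℕ v) (m∣m*n (toℕ v)) ⟩
    (m * toℕ v) % n              ≡⟨ toℕ-mod (m * toℕ v) ⟨
    toℕ (pow m v)                ∎)
    where open ≡-Reasoning

  PosPow⇒InSub : ∀ {u v} → PosPow v u → InSub u v
  PosPow⇒InSub (m , _ , e) = m , e

  Gen⇒index≡ : ∀ {x v} → Gen x v → index⟨ v ⟩ ≡ index⟨ x ⟩
  Gen⇒index≡ (v∈⟨x⟩ , x∈⟨v⟩) = ∣-antisym (InSub⇒index∣index x∈⟨v⟩) (InSub⇒index∣index v∈⟨x⟩)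

  index≡⇒Gen : ∀ {x v} → index⟨ v ⟩ ≡ index⟨ x ⟩ → Gen x v
  index≡⇒Gen eq = index∣index⇒InSub (∣-reflexive (sym eq)) , index∣index⇒InSub (∣-reflexive eq)

  Neighbour : Fin n → Fin n → Set
  Neighbour x v = index⟨ v ⟩ ≢ index⟨ x ⟩ × (index⟨ x ⟩ ∣ index⟨ v ⟩ ⊎ index⟨ v ⟩ ∣ index⟨ x ⟩)

  NGen⇔Neighbour : ∀ x v → NGen x v ⇔ Neighbour x v
  NGen⇔Neighbour x v = mk⇔ to from
    where
    to : NGen x v → Neighbour x v
    to (v∉[x] , a , a∈[x] , _ , a~v) = v∉[x] ∘ index≡⇒Gen ,
      subst (λ g → g ∣ index⟨ v ⟩ ⊎ index⟨ v ⟩ ∣ g) (Gen⇒index≡ a∈[x])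
        (Sum.map (InSub⇒index∣index ∘ PosPow⇒InSub) (InSub⇒index∣index ∘ PosPow⇒InSub) a~v)

    from : Neighbour x v → NGen x v
    from (v≢x , comparable) = v≢x ∘ Gen⇒index≡ , x , index≡⇒Gen refl , v≢x ∘ cong index⟨_⟩ ∘ sym ,
      Sum.map (InSub⇒PosPow ∘ index∣index⇒InSub) (InSub⇒PosPow ∘ index∣index⇒InSub) comparable

  pow≡identity⇔ : ∀ m x → pow m x ≡ identity ⇔ n ∣ m * toℕ x
  pow≡identity⇔ m x = mk⇔
    (λ x^m≡1 → m%n≡0⇒n∣m (m * toℕ x) n
      (trans (sym (toℕ-mod (m * toℕ x))) (trans (cong toℕ x^m≡1) toℕ-identity)))
    (λ n∣m*x → toℕ-injective
      (trans (toℕ-mod (m * toℕ x)) (trans (n∣m⇒m%n≡0 (m * toℕ x) n n∣m*x) (sym toℕ-identity))))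

  HasOrder⇒n≡index*order : ∀ {x d} → HasOrder x d → n ≡ index⟨ x ⟩ * d
  HasOrder⇒n≡index*order {x} {d} (1≤d , x^d≡1 , minimal)
    with divides q n≡q*g ← gcd[m,n]∣n (toℕ x) n = begin
      n                ≡⟨ n≡q*g ⟩
      q * index⟨ x ⟩   ≡⟨ cong (_* index⟨ x ⟩) q≡d ⟩
      d * index⟨ x ⟩   ≡⟨ *-comm d index⟨ x ⟩ ⟩
      index⟨ x ⟩ * d   ∎
    where
    open ≡-Reasoning
    x^m≡1⇔q∣m : ∀ m → pow m x ≡ identity ⇔ q ∣ m
    x^m≡1⇔q∣m m = ⇔.trans (pow≡identity⇔ m x) (n∣m*v⇔q∣m (sym n≡q*g))
    1≤q : 1 ≤ q
    1≤q = n≢0⇒n>0 (λ q≡0 → ≢-nonZero⁻¹ n (trans n≡q*g (cong (_* index⟨ x ⟩) q≡0)))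
    instance
      d≢0 : NonZero d
      d≢0 = >-nonZero 1≤d
    q≡d : q ≡ d
    q≡d = ≤-antisym (∣⇒≤ (Equivalence.to (x^m≡1⇔q∣m d) x^d≡1))
                    (minimal q 1≤q (Equivalence.from (x^m≡1⇔q∣m q) ∣-refl))

  _⊕_ : Fin n → Fin n → Fin n
  v ⊕ y = (toℕ v + toℕ y) mod n

  ⊕-cancelʳ : ∀ {v w} y → v ⊕ y ≡ w ⊕ y → v ≡ w
  ⊕-cancelʳ {v} {w} y eq = toℕ-injective (+-cancelʳ-% (toℕ y) (toℕ<n v) (toℕ<n w) (<⇒≤ (toℕ<n y))
    (trans (sym (toℕ-mod (toℕ v + toℕ y))) (trans (cong toℕ eq) (toℕ-mod (toℕ w + toℕ y)))))

  identity-⊕ : ∀ y → identity ⊕ y ≡ y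
  identity-⊕ y = toℕ-injective (trans (toℕ-mod (toℕ identity + toℕ y))
    (trans (cong (λ z → (z + toℕ y) % n) toℕ-identity) (m<n⇒m%n≡m (toℕ<n y))))

  index⟨⊕⟩ : ∀ v y → index⟨ v ⊕ y ⟩ ≡ gcd (toℕ v + toℕ y) n
  index⟨⊕⟩ v y =
    trans (cong (λ z → gcd z n) (toℕ-mod (toℕ v + toℕ y))) (gcd[m%n,n]≡gcd[m,n] (toℕ v + toℕ y))

module NeighbourInjection {n p β γ : ℕ} .{{_ : NonZero n}} {x y : Fin n}
         (prime-p : Prime p) (1≤β : 1 ≤ β) (β<γ : β < γ)
         (order-x : CyclicGroup.HasOrder n x (p ^ β)) (order-y : CyclicGroup.HasOrder n y (p ^ γ)) where
  open CyclicGroup n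

  private
    instance
      p≢0 : NonZero p
      p≢0 = prime⇒nonZero prime-p
      p^β≢0 : NonZero (p ^ β)
      p^β≢0 = m^n≢0 p β

    a b δ : ℕ
    a = index⟨ x ⟩
    b = index⟨ y ⟩
    δ = γ ∸ suc β

    instance
      a≢0 : NonZero a
      a≢0 = gcd[m,n]-nonZero (toℕ x) n
      b≢0 : NonZero b
      b≢0 = gcd[m,n]-nonZero (toℕ y) n

    n≡a*p^β : n ≡ a * p ^ β
    n≡a*p^β = HasOrder⇒n≡index*order order-x

    n≡b*p^γ : n ≡ b * p ^ γ
    n≡b*p^γ = HasOrder⇒n≡index*order order-y

    a≡b*p^[1+δ] : a ≡ b * p ^ suc δ
    a≡b*p^[1+δ] = *-cancelʳ-≡ a (b * p ^ suc δ) (p ^ β) (begin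
      a * p ^ β                  ≡⟨ n≡a*p^β ⟨
      n                          ≡⟨ n≡b*p^γ ⟩
      b * p ^ γ                  ≡⟨ cong (λ e → b * p ^ e) (sym (trans (+-suc β δ) (m+[n∸m]≡n β<γ))) ⟩
      b * p ^ (β + suc δ)        ≡⟨ cong (b *_) (^-distribˡ-+-* p β (suc δ)) ⟩
      b * (p ^ β * p ^ suc δ)    ≡⟨ cong (b *_) (*-comm (p ^ β) (p ^ suc δ)) ⟩
      b * (p ^ suc δ * p ^ β)    ≡⟨ *-assoc b (p ^ suc δ) (p ^ β) ⟨
      b * p ^ suc δ * p ^ β      ∎)
      where open ≡-Reasoning

    b*p∣a : b * p ∣ a
    b*p∣a = subst (b * p ∣_) (trans (*-assoc b p (p ^ δ)) (sym a≡b*p^[1+δ])) (m∣m*n (p ^ δ))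

    b∣a : b ∣ a
    b∣a = ∣-trans (m∣m*n p) b*p∣a

    b≢a : b ≢ a
    b≢a b≡a = b*p∤b prime-p (subst (b * p ∣_) (sym b≡a) b*p∣a)

    a≢n : a ≢ n
    a≢n a≡n = b*p∤b prime-p (subst (a * p ∣_) (trans (sym n≡a*p^β) (sym a≡n)) (*-monoʳ-∣ a p∣p^β))
      where
      p∣p^β : p ∣ p ^ β
      p∣p^β = subst (_∣ p ^ β) (*-identityʳ p) (^-monoʳ-∣ p 1≤β)

    comparable-with-a : ∀ {c} → b ∣ c → c ∣ n → a ∣ c ⊎ c ∣ a
    comparable-with-a {c} b∣c c∣n
      with j , c≡b*p^j ← ∣b*p^k⇒≡b*p^j {k = γ} prime-p b∣c (subst (c ∣_) n≡b*p^γ c∣n)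
      = b*p^i-comparable b p {suc δ} {j} a≡b*p^[1+δ] c≡b*p^j

    index⟨v⊕y⟩≡b : ∀ {v} → index⟨ v ⟩ ≡ a → index⟨ v ⊕ y ⟩ ≡ b
    index⟨v⊕y⟩≡b {v} index⟨v⟩≡a =
      trans (index⟨⊕⟩ v y) (gcd[u+y,n]≡gcd[y,n] {k = γ} prime-p n≡b*p^γ (∣-trans b*p∣a a∣v))
      where
      a∣v : a ∣ toℕ v
      a∣v = subst (_∣ toℕ v) index⟨v⟩≡a (gcd[m,n]∣m (toℕ v) n)

    v⊕y≢y : ∀ {v} → index⟨ v ⟩ ≡ a → v ⊕ y ≢ y
    v⊕y≢y {v} index⟨v⟩≡a v⊕y≡y = a≢n (begin
      a                  ≡⟨ index⟨v⟩≡a ⟨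
      index⟨ v ⟩         ≡⟨ cong index⟨_⟩ (⊕-cancelʳ y (trans v⊕y≡y (sym (identity-⊕ y)))) ⟩
      index⟨ identity ⟩  ≡⟨ index⟨identity⟩ ⟩
      n                  ∎)
      where open ≡-Reasoning

  φ : Fin n → Fin n
  φ v with index⟨ v ⟩ ≟ a
  ... | yes _ = v ⊕ y
  ... | no  _ = v

  y-Neighbour : Neighbour x y
  y-Neighbour = b≢a , inj₂ b∣a

  φ-Neighbour : ∀ {v} → Neighbour y v → Neighbour x (φ v)
  φ-Neighbour {v} (v≢y , comparable) with index⟨ v ⟩ ≟ a
  ... | yes index⟨v⟩≡a = subst (λ g → g ≢ a × (a ∣ g ⊎ g ∣ a)) (sym index⟨φv⟩≡b) y-Neighbour
    where
    index⟨φv⟩≡b : index⟨ v ⊕ y ⟩ ≡ b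
    index⟨φv⟩≡b = index⟨v⊕y⟩≡b index⟨v⟩≡a
  ... | no  index⟨v⟩≢a = index⟨v⟩≢a , comparable-with-y comparable
    where
    comparable-with-y : b ∣ index⟨ v ⟩ ⊎ index⟨ v ⟩ ∣ b → a ∣ index⟨ v ⟩ ⊎ index⟨ v ⟩ ∣ a
    comparable-with-y (inj₁ b∣v) = comparable-with-a b∣v (gcd[m,n]∣n (toℕ v) n)
    comparable-with-y (inj₂ v∣b) = inj₂ (∣-trans v∣b b∣a)

  φ-injective : ∀ {v w} → Neighbour y v → Neighbour y w → φ v ≡ φ w → v ≡ w
  φ-injective {v} {w} (v≢y , _) (w≢y , _) φv≡φw with index⟨ v ⟩ ≟ a | index⟨ w ⟩ ≟ a
  ... | yes _          | yes _          = ⊕-cancelʳ y φv≡φw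
  ... | yes index⟨v⟩≡a | no  _          =
    ⊥-elim (w≢y (trans (cong index⟨_⟩ (sym φv≡φw)) (index⟨v⊕y⟩≡b index⟨v⟩≡a)))
  ... | no  _          | yes index⟨w⟩≡a =
    ⊥-elim (v≢y (trans (cong index⟨_⟩ φv≡φw) (index⟨v⊕y⟩≡b index⟨w⟩≡a)))
  ... | no  _          | no  _          = φv≡φw

  φ≢y : ∀ {v} → Neighbour y v → φ v ≢ y
  φ≢y {v} (v≢y , _) with index⟨ v ⟩ ≟ a
  ... | yes index⟨v⟩≡a = v⊕y≢y index⟨v⟩≡a
  ... | no  _          = v≢y ∘ cong index⟨_⟩

mainTheorem3 : (n r : ℕ) → 2 ≤ r → (p α : Fin r → ℕ)
    → (∀ i → Prime (p i)) → (∀ i j → i F.< j → p i < p j) → (∀ i → 1 ≤ α i)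
    → n ≡ prodFin r (λ i → p i ^ α i) → .{{_ : NonZero n}}
    → (k : Fin r) → (β γ : ℕ) → 1 ≤ β → β < γ
    → (x y : Fin n) → Cyclic.HasOrder n x (p k ^ β) → Cyclic.HasOrder n y (p k ^ γ)
    → (Lx Ly : List (Fin n)) → Unique Lx → Unique Ly
    → (∀ v → (v ∈ Lx) ⇔ Cyclic.NGen n x v) → (∀ v → (v ∈ Ly) ⇔ Cyclic.NGen n y v)
    → length Ly < length Lx
mainTheorem3 n _ _ p _ p-prime _ _ _ k β γ 1≤β β<γ x y order-x order-y Lx Ly _ unique-Ly Lx-spec Ly-spec =
  injectiveOn∧missing⇒length< φ unique-Ly
    (λ {v} v∈Ly → Lx∋ (φ-Neighbour {v} (Ly⊆ v∈Ly)))
    (λ {v} {w} v∈Ly w∈Ly → φ-injective {v} {w} (Ly⊆ v∈Ly) (Ly⊆ w∈Ly))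
    (Lx∋ y-Neighbour)
    (λ {v} v∈Ly → φ≢y {v} (Ly⊆ v∈Ly))
  where
  open CyclicGroup n
  open NeighbourInjection (p-prime k) 1≤β β<γ order-x order-y
  Lx∋ : ∀ {v} → Neighbour x v → v ∈ Lx
  Lx∋ {v} = Equivalence.from (⇔.trans (Lx-spec v) (NGen⇔Neighbour x v))
  Ly⊆ : ∀ {v} → v ∈ Ly → Neighbour y v
  Ly⊆ {v} = Equivalence.to (⇔.trans (Ly-spec v) (NGen⇔Neighbour y v))
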